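{- If $\mathfrak F\in\mathsf{LBWE}$, then for every formula $\varphi$, the formula $\mathsf E\varphi\leftrightarrow(\langle B\rangle(\varphi,\top)\vee\varphi)$ is valid on $\mathfrak F$.
   Context: A 3-frame is $\langle W,B\rangle$, $B\subseteq W^3$; $\#(x,y,z)$ means pairwise distinct. $\mathsf{LBWE}$: 3-frames satisfying (B1) $B(x,y,z)\to\#(x,y,z)$; (B2) $B(x,y,z)\to B(z,y,x)$; (B3) $B(x,y,z)\to\neg B(x,z,y)$; (B4) $B(x,y,z)\wedge B(y,z,u)\to B(x,y,u)$; (B5) $B(x,y,z)\wedge B(y,u,z)\to B(x,y,u)$; (B6) $\#(x,y,z)\to B(x,y,z)\vee B(x,z,y)\vee B(y,x,z)$; (B7) $\forall y\exists x\exists z\,B(x,y,z)$. Formulas are those of the hybrid language with $\top$, propositional variables, nominals, $\neg,\wedge$, the binary modality $\langle B\rangle$, satisfaction operators $@_i$ and the existential modality $\mathsf E$. Valuations map variables to subsets and nominals to singletons; $w\Vdash\langle B\rangle(\varphi,\psi)$ iff there are $x,y$ with $x\Vdash\varphi$, $y\Vdash\psi$ and $B(x,w,y)$; $w\Vdash @_i\varphi$ iff the element of $V(i)$ satisfies $\varphi$; $w\Vdash\mathsf E\varphi$ iff some point of $W$ satisfies $\varphi$. -}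

module Defs where

open import Data.Nat using (ℕ)
open import Data.Product using (_×_; Σ; ∃; ∃-syntax; _,_)
open import Data.Sum using (_⊎_)
open import Data.Unit using (⊤)
open import Relation.Nullary using (¬_)
open import Relation.Binary.PropositionalEquality using (_≡_; _≢_)

record Frame₃ : Set₁ where
  field
    W : Set
    B : W → W → W → Set

#₃ : {W : Set} → W → W → W → Set
#₃ x y z = (x ≢ y) × (y ≢ z) × (x ≢ z)

record IsLBWE (F : Frame₃) : Set where
  open Frame₃ F
  field
    B1 : ∀ {x y z} → B x y z → #₃ x y z
    B2 : ∀ {x y z} → B x y z → B z y x
    B3 : ∀ {x y z} → B x y z → ¬ B x z y
    B4 : ∀ {x y z u} → B x y z → B y z u → B x y u
    B5 : ∀ {x y z u} → B x y z → B y u z → B x y u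
    B6 : ∀ {x y z} → #₃ x y z → B x y z ⊎ B x z y ⊎ B y x z
    B7 : ∀ y → ∃[ x ] ∃[ z ] B x y z

PVar : Set
PVar = ℕ

Nom : Set
Nom = ℕ

data Form : Set where
  ⊤'   : Form
  var  : PVar → Form
  nom  : Nom → Form
  ¬'_  : Form → Form
  _∧'_ : Form → Form → Form
  ⟨B⟩  : Form → Form → Form
  at   : Nom → Form → Form
  E'   : Form → Form

_∨'_ : Form → Form → Form
φ ∨' ψ = ¬' ((¬' φ) ∧' (¬' ψ))

_⇒'_ : Form → Form → Form
φ ⇒' ψ = ¬' (φ ∧' (¬' ψ))

_⇔'_ : Form → Form → Form
φ ⇔' ψ = (φ ⇒' ψ) ∧' (ψ ⇒' φ)

record Valuation (W : Set) : Set₁ where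
  field
    V   : PVar → W → Set
    ν   : Nom → W

module _ (F : Frame₃) where
  open Frame₃ F

  sat : Valuation W → W → Form → Set
  sat M w ⊤'        = ⊤
  sat M w (var p)   = Valuation.V M p w
  sat M w (nom i)   = w ≡ Valuation.ν M i
  sat M w (¬' φ)    = ¬ sat M w φ
  sat M w (φ ∧' ψ)  = sat M w φ × sat M w ψ
  sat M w (⟨B⟩ φ ψ) = ∃[ x ] ∃[ y ] (sat M x φ × sat M y ψ × B x w y)
  sat M w (at i φ)  = sat M (Valuation.ν M i) φ
  sat M w (E' φ)    = ∃[ v ] sat M v φ

  Valid : Form → Set₁
  Valid φ = (M : Valuation W) (w : W) → sat M w φ

{-# OPTIONS --safe #-}
module Submission where

-- Eφ → ⟨B⟩(φ, ⊤) ∨ φ is the only nontrivial direction.  If φ holds at some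
-- v ≠ w, then w lies strictly between v and some point: by (B7) w is the
-- middle of some triple x w z, and the linearity axiom (B6) together with
-- (B4)/(B5) lets the endpoint x be replaced by v.

open import Defs
open import Data.Product using (_,_; proj₁; ∃-syntax)
open import Data.Sum using (inj₁; inj₂)
open import Data.Unit using (tt)
open import Function using (_∘_)
open import Relation.Nullary using (¬_)
open import Relation.Binary.PropositionalEquality using (refl; sym; _≢_)

module _ {F : Frame₃} (L : IsLBWE F) where
  open Frame₃ F
  open IsLBWE L

  B-replace-endpoint : ∀ {x w z v} → B x w z → x ≢ v → w ≢ v → ∃[ y ] B v w y
  B-replace-endpoint {x} {w} {z} bxwz x≢v w≢v with B6 (proj₁ (B1 bxwz) , w≢v , x≢v)
  ... | inj₁ bxwv         = x , B2 bxwv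
  ... | inj₂ (inj₁ bxvw)  = z , B2 (B5 (B2 bxwz) (B2 bxvw))
  ... | inj₂ (inj₂ bwxv)  = z , B2 (B4 (B2 bxwz) bwxv)

  -- Only doubly negated: equality on W need not be decidable, so we cannot
  -- decide whether the endpoint supplied by (B7) is v itself.
  ¬¬B-through : ∀ {v w} → v ≢ w → ¬ ¬ (∃[ y ] B v w y)
  ¬¬B-through {v} {w} v≢w ¬B with B7 w
  ... | x , z , bxwz = ¬B (B-replace-endpoint bxwz x≢v (v≢w ∘ sym))
    where
    x≢v : x ≢ v
    x≢v refl = ¬B (z , bxwz)

theorem6p1 : (F : Frame₃) → IsLBWE F → (φ : Form) →
    Valid F ((E' φ) ⇔' ((⟨B⟩ φ ⊤') ∨' φ))
theorem6p1 F L φ M w = E⇒ , ⇒E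
  where
  E⇒ : sat F M w (E' φ ⇒' (⟨B⟩ φ ⊤' ∨' φ))
  E⇒ ((v , v⊨φ) , ¬disj) = ¬disj λ (w⊭⟨B⟩ , w⊭φ) →
    ¬¬B-through L (λ { refl → w⊭φ v⊨φ }) λ (y , bvwy) → w⊭⟨B⟩ (v , y , v⊨φ , tt , bvwy)

  ⇒E : sat F M w ((⟨B⟩ φ ⊤' ∨' φ) ⇒' E' φ)
  ⇒E (disj , ¬Eφ) = disj ((λ (x , _ , x⊨φ , _) → ¬Eφ (x , x⊨φ)) , λ w⊨φ → ¬Eφ (w , w⊨φ))
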